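{- Let $r\ge 2$ and let $\mathcal{H}$ be an $r$-uniform hypergraph on $n$ vertices such that every set of $r+1$ vertices contains at most $2$ hyperedges. Then \[ |E(\mathcal{H})| \le \frac{n}{r^2}\binom{n}{r-1}, \] with equality if and only if every set of $r-1$ vertices is contained in exactly $n/r$ hyperedges of $\mathcal{H}$. -}

module Defs where

open import Data.Nat using (ℕ; zero; suc)
open import Data.Bool using (Bool; true; false; _∧_; _∨_; not)
open import Data.Vec using (Vec; []; _∷_)
open import Data.List using (List; []; _∷_; map; _++_; filterᵇ; length)
open import Data.Fin.Subset using (Subset; ∣_∣)
open import Relation.Binary.PropositionalEquality using (_≡_)

allSubsets : (n : ℕ) → List (Subset n)
allSubsets zero    = [] ∷ []
allSubsets (suc n) = map (false ∷_) (allSubsets n) ++ map (true ∷_) (allSubsets n)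

_⊆ᵇ_ : ∀ {n} → Subset n → Subset n → Bool
[]      ⊆ᵇ []      = true
(x ∷ s) ⊆ᵇ (y ∷ t) = (not x ∨ y) ∧ (s ⊆ᵇ t)

record Hypergraph (n : ℕ) : Set where
  field
    isEdge : Subset n → Bool
open Hypergraph public

Uniform : ∀ {n} → ℕ → Hypergraph n → Set
Uniform r H = ∀ S → isEdge H S ≡ true → ∣ S ∣ ≡ r

edges : ∀ {n} → Hypergraph n → List (Subset n)
edges {n} H = filterᵇ (isEdge H) (allSubsets n)

numEdges : ∀ {n} → Hypergraph n → ℕ
numEdges H = length (edges H)

edgesInside : ∀ {n} → Hypergraph n → Subset n → ℕ
edgesInside H T = length (filterᵇ (λ e → e ⊆ᵇ T) (edges H))

degree : ∀ {n} → Hypergraph n → Subset n → ℕ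
degree H S = length (filterᵇ (λ e → S ⊆ᵇ e) (edges H))

-- Write d(S) for the degree of a vertex set S and m for the number of edges. Double counting gives
-- Σ d(S) = r·m and Σ d(S)² = Σ_{e,f} C(∣e ∩ f∣, r−1), the sums running over the (r−1)-sets S. For a
-- fixed edge e the inner sum is r (from f = e) plus the number of edges f with ∣e ∩ f∣ = r−1. Each
-- such f spans with e an (r+1)-set containing e; as an (r+1)-set contains at most one edge besides e,
-- distinct f give distinct sets, so there are at most n − r of them and Σ d(S)² ≤ n·m. Expanding
-- 0 ≤ Σ (r·d(S) − n)² = r²Σ d(S)² − 2nrΣ d(S) + n²C(n, r−1) ≤ n·(n·C(n, r−1) − r²m) gives the
-- bound, with equality exactly when every term r·d(S) − n vanishes.

module Submission where

open import Defs
import Algebra.Properties.CommutativeSemigroup as CommSemigroupProperties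
open import Data.Bool using (Bool; true; false; _∧_; T)
open import Data.Bool.Properties using (∧-zeroʳ) renaming (_≟_ to _≟ᵇ_)
open import Data.Fin.Subset using (Subset; ∣_∣; _∩_; _∪_; ∁)
open import Data.Fin.Subset.Properties using (∣p∩q∣≤∣p∣; ∣p∩q∣≤∣q∣; ∩-idem; ∪-idem; ∣∁p∣≡n∸∣p∣; ∣p∣≤n)
open import Data.List using (List; []; _∷_; map; _++_; filterᵇ; length)
open import Data.List.Properties using (filter-++; length-++)
open import Data.Nat using (ℕ; zero; suc; _+_; _*_; _∸_; _≤_; _<_; z≤n; s≤s; s≤s⁻¹; z<s; _≡ᵇ_; ∣_-_∣; ≢-nonZero)
open import Data.Nat.Combinatorics using (_C_; nCk+nC[k+1]≡[n+1]C[k+1]; k>n⇒nCk≡0; nCk≡nC[n∸k]; nC1≡n; nCn≡1)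
open import Data.Nat.Properties
open import Data.Nat.Tactic.RingSolver using (solve-∀)
open import Data.Product using (_×_; _,_)
open import Data.Sum using (inj₁; inj₂; reduce)
open import Data.Vec using ([]; _∷_)
open import Data.Vec.Properties using (∷-injectiveʳ; ≡-dec)
open import Function using (_∘_)
open import Function.Bundles using (_⇔_; mk⇔)
open import Relation.Binary.Definitions using (DecidableEquality)
open import Relation.Binary.PropositionalEquality
open import Relation.Nullary using (contradiction; yes; no; does)

module +-CS = CommSemigroupProperties +-commutativeSemigroup
module *-CS = CommSemigroupProperties *-commutativeSemigroup

-- Indicators and sums over the subsets of Fin n

⟦_⟧ : Bool → ℕ
⟦ true  ⟧ = 1
⟦ false ⟧ = 0

⟦∧⟧ : ∀ a b → ⟦ a ∧ b ⟧ ≡ ⟦ a ⟧ * ⟦ b ⟧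
⟦∧⟧ true  b = sym (+-identityʳ ⟦ b ⟧)
⟦∧⟧ false b = refl

≡ᵇ⇒≡′ : ∀ {m n} → (m ≡ᵇ n) ≡ true → m ≡ n
≡ᵇ⇒≡′ {m} {n} eq = ≡ᵇ⇒≡ m n (subst T (sym eq) _)

⟦n≡ᵇn⟧ : ∀ n → ⟦ n ≡ᵇ n ⟧ ≡ 1
⟦n≡ᵇn⟧ zero    = refl
⟦n≡ᵇn⟧ (suc n) = ⟦n≡ᵇn⟧ n

m≤n⇒⟦1+n≡ᵇm⟧≡0 : ∀ {m n} → m ≤ n → ⟦ suc n ≡ᵇ m ⟧ ≡ 0
m≤n⇒⟦1+n≡ᵇm⟧≡0 z≤n       = refl
m≤n⇒⟦1+n≡ᵇm⟧≡0 (s≤s m≤n) = m≤n⇒⟦1+n≡ᵇm⟧≡0 m≤n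

∑ : ∀ {n} → (Subset n → ℕ) → ℕ
∑ {zero}  f = f []
∑ {suc n} f = ∑ (f ∘ (false ∷_)) + ∑ (f ∘ (true ∷_))

syntax ∑ (λ S → e) = ∑[ S ] e

-- The size n of the ground set cannot be inferred from a summand, hence the occasional explicit {n}.

∑-cong : ∀ {n} {f g : Subset n → ℕ} → (∀ S → f S ≡ g S) → ∑ f ≡ ∑ g
∑-cong {zero}  eq = eq []
∑-cong {suc n} eq = cong₂ _+_ (∑-cong (eq ∘ (false ∷_))) (∑-cong (eq ∘ (true ∷_)))

∑-mono : ∀ {n} {f g : Subset n → ℕ} → (∀ S → f S ≤ g S) → ∑ f ≤ ∑ g
∑-mono {zero}  le = le []
∑-mono {suc n} le = +-mono-≤ (∑-mono (le ∘ (false ∷_))) (∑-mono (le ∘ (true ∷_)))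

∑-+ : ∀ {n} (f g : Subset n → ℕ) → ∑[ S ] (f S + g S) ≡ ∑ f + ∑ g
∑-+ {zero}  f g = refl
∑-+ {suc n} f g =
  trans (cong₂ _+_ (∑-+ (f ∘ (false ∷_)) (g ∘ (false ∷_))) (∑-+ (f ∘ (true ∷_)) (g ∘ (true ∷_))))
        (+-CS.interchange (∑ (f ∘ (false ∷_))) _ (∑ (f ∘ (true ∷_))) _)

∑-*ˡ : ∀ {n} c (f : Subset n → ℕ) → ∑[ S ] (c * f S) ≡ c * ∑ f
∑-*ˡ {zero}  c f = refl
∑-*ˡ {suc n} c f = trans (cong₂ _+_ (∑-*ˡ c (f ∘ (false ∷_))) (∑-*ˡ c (f ∘ (true ∷_))))
                         (sym (*-distribˡ-+ c _ _))

∑-swap : ∀ {m n} (f : Subset m → Subset n → ℕ) → ∑[ S ] ∑[ T ] f S T ≡ ∑[ T ] ∑[ S ] f S T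
∑-swap {zero}  f = refl
∑-swap {suc m} f = trans (cong₂ _+_ (∑-swap (f ∘ (false ∷_))) (∑-swap (f ∘ (true ∷_))))
                         (sym (∑-+ (λ T → ∑[ S ] f (false ∷ S) T) (λ T → ∑[ S ] f (true ∷ S) T)))

∑-zero : ∀ {n} {f : Subset n → ℕ} → (∀ S → f S ≡ 0) → ∑ f ≡ 0
∑-zero {zero}  eq = eq []
∑-zero {suc n} eq = cong₂ _+_ (∑-zero (eq ∘ (false ∷_))) (∑-zero (eq ∘ (true ∷_)))

∑-point : ∀ {n} {f : Subset n → ℕ} P → (∀ S → S ≢ P → f S ≡ 0) → ∑ f ≡ f P
∑-point {zero}  []        off = refl
∑-point {suc n} (false ∷ P) off = trans
  (cong₂ _+_ (∑-point P λ S S≢P → off (false ∷ S) (S≢P ∘ ∷-injectiveʳ))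
             (∑-zero λ S → off (true ∷ S) λ ()))
  (+-identityʳ _)
∑-point {suc n} (true ∷ P) off =
  cong₂ _+_ (∑-zero λ S → off (false ∷ S) λ ())
            (∑-point P λ S S≢P → off (true ∷ S) (S≢P ∘ ∷-injectiveʳ))

term≤∑ : ∀ {n} (f : Subset n → ℕ) S → f S ≤ ∑ f
term≤∑ f []          = ≤-refl
term≤∑ f (false ∷ S) = ≤-trans (term≤∑ (f ∘ (false ∷_)) S) (m≤m+n _ _)
term≤∑ f (true ∷ S)  = ≤-trans (term≤∑ (f ∘ (true ∷_)) S) (m≤n+m _ _)

∑-*-∑ : ∀ {m n} (f : Subset m → ℕ) (g : Subset n → ℕ) → ∑ f * ∑ g ≡ ∑[ S ] ∑[ T ] (f S * g T)
∑-*-∑ f g = begin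
  ∑ f * ∑ g                  ≡⟨ *-comm (∑ f) (∑ g) ⟩
  ∑ g * ∑ f                  ≡⟨ ∑-*ˡ (∑ g) f ⟨
  ∑[ S ] (∑ g * f S)         ≡⟨ ∑-cong (λ S → trans (*-comm (∑ g) (f S)) (sym (∑-*ˡ (f S) g))) ⟩
  ∑[ S ] ∑[ T ] (f S * g T)  ∎
  where open ≡-Reasoning

∑-*-+ : ∀ {n} (g a d : Subset n → ℕ) c →
  ∑[ f ] (g f * (a f + c * d f)) ≡ ∑[ f ] (g f * a f) + c * ∑[ f ] (g f * d f)
∑-*-+ g a d c = begin
  ∑[ f ] (g f * (a f + c * d f))
    ≡⟨ ∑-cong (λ f → trans (*-distribˡ-+ (g f) _ _) (cong (g f * a f +_) (*-CS.x∙yz≈y∙xz (g f) c (d f)))) ⟩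
  ∑[ f ] (g f * a f + c * (g f * d f))
    ≡⟨ ∑-+ (λ f → g f * a f) (λ f → c * (g f * d f)) ⟩
  ∑[ f ] (g f * a f) + ∑[ f ] (c * (g f * d f))
    ≡⟨ cong (∑[ f ] (g f * a f) +_) (∑-*ˡ c (λ f → g f * d f)) ⟩
  ∑[ f ] (g f * a f) + c * ∑[ f ] (g f * d f) ∎
  where open ≡-Reasoning

_≟ˢ_ : ∀ {n} → DecidableEquality (Subset n)
_≟ˢ_ = ≡-dec _≟ᵇ_

δ : ∀ {n} → Subset n → Subset n → ℕ
δ e f = ⟦ does (e ≟ˢ f) ⟧

∑-δ : ∀ {n} (g : Subset n → ℕ) e → ∑[ f ] (g f * δ e f) ≡ g e
∑-δ g e = trans (∑-point e off) on
  where
  off : ∀ f → f ≢ e → g f * δ e f ≡ 0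
  off f f≢e with e ≟ˢ f
  ... | yes e≡f = contradiction (sym e≡f) f≢e
  ... | no  _   = *-zeroʳ (g f)
  on : g e * δ e e ≡ g e
  on with e ≟ˢ e
  ... | yes _   = *-identityʳ (g e)
  ... | no  e≢e = contradiction refl e≢e

-- Counting subsets

length-filterᵇ-map : ∀ {A B : Set} (p : B → Bool) (g : A → B) (xs : List A) →
  length (filterᵇ p (map g xs)) ≡ length (filterᵇ (p ∘ g) xs)
length-filterᵇ-map p g []       = refl
length-filterᵇ-map p g (x ∷ xs) with p (g x)
... | true  = cong suc (length-filterᵇ-map p g xs)
... | false = length-filterᵇ-map p g xs

length-filterᵇ-filterᵇ : ∀ {A : Set} (p q : A → Bool) (xs : List A) →
  length (filterᵇ q (filterᵇ p xs)) ≡ length (filterᵇ (λ x → p x ∧ q x) xs)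
length-filterᵇ-filterᵇ p q []       = refl
length-filterᵇ-filterᵇ p q (x ∷ xs) with p x
... | false = length-filterᵇ-filterᵇ p q xs
... | true with q x
...   | true  = cong suc (length-filterᵇ-filterᵇ p q xs)
...   | false = length-filterᵇ-filterᵇ p q xs

length-filterᵇ-allSubsets : ∀ {n} (p : Subset n → Bool) →
  length (filterᵇ p (allSubsets n)) ≡ ∑[ S ] ⟦ p S ⟧
length-filterᵇ-allSubsets {zero} p with p []
... | true  = refl
... | false = refl
length-filterᵇ-allSubsets {suc n} p = begin
  length (filterᵇ p (map (false ∷_) A ++ map (true ∷_) A))
    ≡⟨ cong length (filter-++ _ (map (false ∷_) A) _) ⟩
  length (filterᵇ p (map (false ∷_) A) ++ filterᵇ p (map (true ∷_) A))
    ≡⟨ length-++ (filterᵇ p (map (false ∷_) A)) ⟩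
  length (filterᵇ p (map (false ∷_) A)) + length (filterᵇ p (map (true ∷_) A))
    ≡⟨ cong₂ _+_ (length-filterᵇ-map p (false ∷_) A) (length-filterᵇ-map p (true ∷_) A) ⟩
  length (filterᵇ (p ∘ (false ∷_)) A) + length (filterᵇ (p ∘ (true ∷_)) A)
    ≡⟨ cong₂ _+_ (length-filterᵇ-allSubsets (p ∘ (false ∷_))) (length-filterᵇ-allSubsets (p ∘ (true ∷_))) ⟩
  ∑[ S ] ⟦ p S ⟧ ∎
  where
  open ≡-Reasoning
  A : List (Subset n)
  A = allSubsets n

⊆ᵇ-∩ : ∀ {n} (S e f : Subset n) → (S ⊆ᵇ e) ∧ (S ⊆ᵇ f) ≡ S ⊆ᵇ (e ∩ f)
⊆ᵇ-∩ []          []          []          = refl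
⊆ᵇ-∩ (false ∷ S) (_ ∷ e)     (_ ∷ f)     = ⊆ᵇ-∩ S e f
⊆ᵇ-∩ (true ∷ S)  (true ∷ e)  (true ∷ f)  = ⊆ᵇ-∩ S e f
⊆ᵇ-∩ (true ∷ S)  (true ∷ e)  (false ∷ f) = ∧-zeroʳ (S ⊆ᵇ e)
⊆ᵇ-∩ (true ∷ S)  (false ∷ e) (_ ∷ f)     = refl

∪-⊆ᵇ : ∀ {n} (e f T : Subset n) → (e ⊆ᵇ T) ∧ (f ⊆ᵇ T) ≡ (e ∪ f) ⊆ᵇ T
∪-⊆ᵇ []          []          []          = refl
∪-⊆ᵇ (false ∷ e) (false ∷ f) (_ ∷ T)     = ∪-⊆ᵇ e f T
∪-⊆ᵇ (false ∷ e) (true ∷ f)  (true ∷ T)  = ∪-⊆ᵇ e f T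
∪-⊆ᵇ (true ∷ e)  (false ∷ f) (true ∷ T)  = ∪-⊆ᵇ e f T
∪-⊆ᵇ (true ∷ e)  (true ∷ f)  (true ∷ T)  = ∪-⊆ᵇ e f T
∪-⊆ᵇ (false ∷ e) (true ∷ f)  (false ∷ T) = ∧-zeroʳ (e ⊆ᵇ T)
∪-⊆ᵇ (true ∷ e)  (_ ∷ f)     (false ∷ T) = refl

⊆ᵇ⇒∣∣≤ : ∀ {n} (S T : Subset n) → S ⊆ᵇ T ≡ true → ∣ S ∣ ≤ ∣ T ∣
⊆ᵇ⇒∣∣≤ []          []          _  = z≤n
⊆ᵇ⇒∣∣≤ (true ∷ S)  (true ∷ T)  le = s≤s (⊆ᵇ⇒∣∣≤ S T le)
⊆ᵇ⇒∣∣≤ (false ∷ S) (true ∷ T)  le = m≤n⇒m≤1+n (⊆ᵇ⇒∣∣≤ S T le)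
⊆ᵇ⇒∣∣≤ (false ∷ S) (false ∷ T) le = ⊆ᵇ⇒∣∣≤ S T le

∣p∩q∣+∣p∪q∣≡∣p∣+∣q∣ : ∀ {n} (p q : Subset n) → ∣ p ∩ q ∣ + ∣ p ∪ q ∣ ≡ ∣ p ∣ + ∣ q ∣
∣p∩q∣+∣p∪q∣≡∣p∣+∣q∣ []          []          = refl
∣p∩q∣+∣p∪q∣≡∣p∣+∣q∣ (true ∷ p)  (true ∷ q)  = cong suc (begin
  ∣ p ∩ q ∣ + suc ∣ p ∪ q ∣    ≡⟨ +-suc _ _ ⟩
  suc (∣ p ∩ q ∣ + ∣ p ∪ q ∣)  ≡⟨ cong suc (∣p∩q∣+∣p∪q∣≡∣p∣+∣q∣ p q) ⟩
  suc (∣ p ∣ + ∣ q ∣)          ≡⟨ +-suc _ _ ⟨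
  ∣ p ∣ + suc ∣ q ∣            ∎)
  where open ≡-Reasoning
∣p∩q∣+∣p∪q∣≡∣p∣+∣q∣ (true ∷ p)  (false ∷ q) =
  trans (+-suc _ _) (cong suc (∣p∩q∣+∣p∪q∣≡∣p∣+∣q∣ p q))
∣p∩q∣+∣p∪q∣≡∣p∣+∣q∣ (false ∷ p) (true ∷ q)  =
  trans (+-suc _ _) (trans (cong suc (∣p∩q∣+∣p∪q∣≡∣p∣+∣q∣ p q)) (sym (+-suc _ _)))
∣p∩q∣+∣p∪q∣≡∣p∣+∣q∣ (false ∷ p) (false ∷ q) = ∣p∩q∣+∣p∪q∣≡∣p∣+∣q∣ p q

∣p∩q∣≡∣p∣≡∣q∣⇒p≡q : ∀ {n} (p q : Subset n) → ∣ p ∩ q ∣ ≡ ∣ p ∣ → ∣ p ∩ q ∣ ≡ ∣ q ∣ → p ≡ q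
∣p∩q∣≡∣p∣≡∣q∣⇒p≡q []          []          _   _   = refl
∣p∩q∣≡∣p∣≡∣q∣⇒p≡q (true ∷ p)  (true ∷ q)  eqp eqq =
  cong (true ∷_) (∣p∩q∣≡∣p∣≡∣q∣⇒p≡q p q (suc-injective eqp) (suc-injective eqq))
∣p∩q∣≡∣p∣≡∣q∣⇒p≡q (false ∷ p) (false ∷ q) eqp eqq = cong (false ∷_) (∣p∩q∣≡∣p∣≡∣q∣⇒p≡q p q eqp eqq)
∣p∩q∣≡∣p∣≡∣q∣⇒p≡q (true ∷ p)  (false ∷ q) eqp _   =
  contradiction (subst (_≤ ∣ p ∣) eqp (∣p∩q∣≤∣p∣ p q)) (n≮n ∣ p ∣)
∣p∩q∣≡∣p∣≡∣q∣⇒p≡q (false ∷ p) (true ∷ q)  _   eqq =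
  contradiction (subst (_≤ ∣ q ∣) eqq (∣p∩q∣≤∣q∣ p q)) (n≮n ∣ q ∣)

∣p∩q∣≤k : ∀ {n k} (p q : Subset n) → ∣ p ∣ ≡ suc k → ∣ q ∣ ≡ suc k → p ≢ q → ∣ p ∩ q ∣ ≤ k
∣p∩q∣≤k {k = k} p q ∣p∣ ∣q∣ p≢q = s≤s⁻¹ (≤∧≢⇒< (subst (∣ p ∩ q ∣ ≤_) ∣p∣ (∣p∩q∣≤∣p∣ p q)) full⇒≡)
  where
  full⇒≡ : ∣ p ∩ q ∣ ≢ suc k
  full⇒≡ eq = p≢q (∣p∩q∣≡∣p∣≡∣q∣⇒p≡q p q (trans eq (sym ∣p∣)) (trans eq (sym ∣q∣)))

[1+n]Cn≡1+n : ∀ n → suc n C n ≡ suc n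
[1+n]Cn≡1+n n = begin
  suc n C n             ≡⟨ nCk≡nC[n∸k] (n≤1+n n) ⟩
  suc n C (1 + n ∸ n)   ≡⟨ cong (suc n C_) (m+n∸n≡m 1 n) ⟩
  suc n C 1             ≡⟨ nC1≡n (suc n) ⟩
  suc n                 ∎
  where open ≡-Reasoning

∑-size : ∀ n k → ∑ {n} (λ S → ⟦ ∣ S ∣ ≡ᵇ k ⟧) ≡ n C k
∑-size zero    zero    = refl
∑-size zero    (suc k) = refl
∑-size (suc n) zero    = cong₂ _+_ (∑-size n zero) (∑-zero {n} λ _ → refl)
∑-size (suc n) (suc k) =
  trans (cong₂ _+_ (∑-size n (suc k)) (∑-size n k))
        (trans (+-comm (n C suc k) _) (nCk+nC[k+1]≡[n+1]C[k+1] n k))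

∑-subsets : ∀ {n} (e : Subset n) k → ∑[ S ] (⟦ ∣ S ∣ ≡ᵇ k ⟧ * ⟦ S ⊆ᵇ e ⟧) ≡ ∣ e ∣ C k
∑-subsets []          zero    = refl
∑-subsets []          (suc k) = refl
∑-subsets {suc n} (false ∷ e) k =
  trans (cong₂ _+_ (∑-subsets e k) (∑-zero {n} λ S → *-zeroʳ ⟦ suc ∣ S ∣ ≡ᵇ k ⟧)) (+-identityʳ _)
∑-subsets {suc n} (true ∷ e) zero = cong₂ _+_ (∑-subsets e zero) (∑-zero {n} λ _ → refl)
∑-subsets (true ∷ e)  (suc k) =
  trans (cong₂ _+_ (∑-subsets e (suc k)) (∑-subsets e k))
        (trans (+-comm (∣ e ∣ C suc k) _) (nCk+nC[k+1]≡[n+1]C[k+1] ∣ e ∣ k))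

numSupersets : ∀ {n} → ℕ → Subset n → ℕ
numSupersets k u = ∑[ T ] (⟦ ∣ T ∣ ≡ᵇ k ⟧ * ⟦ u ⊆ᵇ T ⟧)

numSupersets≡ : ∀ {n} (u : Subset n) j → numSupersets (j + ∣ u ∣) u ≡ ∣ ∁ u ∣ C j
numSupersets≡ []          zero    = refl
numSupersets≡ []          (suc j) = refl
numSupersets≡ {suc n} (true ∷ u) j = cong₂ _+_
  (∑-zero {n} λ T → *-zeroʳ ⟦ ∣ T ∣ ≡ᵇ j + suc ∣ u ∣ ⟧)
  (trans (∑-cong λ T → cong (λ s → ⟦ suc ∣ T ∣ ≡ᵇ s ⟧ * ⟦ u ⊆ᵇ T ⟧) (+-suc j ∣ u ∣))
         (numSupersets≡ u j))
numSupersets≡ {suc n} (false ∷ u) zero = cong₂ _+_ (numSupersets≡ u zero) (∑-zero {n} outside)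
  where
  outside : ∀ T → ⟦ suc ∣ T ∣ ≡ᵇ ∣ u ∣ ⟧ * ⟦ u ⊆ᵇ T ⟧ ≡ 0
  outside T with u ⊆ᵇ T in u⊆T
  ... | true  = trans (*-identityʳ _) (m≤n⇒⟦1+n≡ᵇm⟧≡0 (⊆ᵇ⇒∣∣≤ u T u⊆T))
  ... | false = *-zeroʳ ⟦ suc ∣ T ∣ ≡ᵇ ∣ u ∣ ⟧
numSupersets≡ (false ∷ u) (suc j) =
  trans (cong₂ _+_ (numSupersets≡ u (suc j)) (numSupersets≡ u j))
        (trans (+-comm (∣ ∁ u ∣ C suc j) _) (nCk+nC[k+1]≡[n+1]C[k+1] ∣ ∁ u ∣ j))

numSupersets-1+ : ∀ {n k} (u : Subset n) → ∣ u ∣ ≡ k → numSupersets (suc k) u ≡ ∣ ∁ u ∣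
numSupersets-1+ u refl = trans (numSupersets≡ u 1) (nC1≡n ∣ ∁ u ∣)

-- For f ≠ e the left side is 1 exactly when e ∪ f has k + 2 elements, and then e ∪ f is counted on the
-- right; the δ terms make the diagonal f = e an equality ∣∁ e∣ + (k + 1) on both sides.
C-overlap≤ : ∀ {n k} (e f : Subset n) → ∣ e ∣ ≡ suc k → ∣ f ∣ ≡ suc k →
  ∣ e ∩ f ∣ C k + ∣ ∁ e ∣ * δ e f ≤ numSupersets (suc (suc k)) (e ∪ f) + suc k * δ e f
C-overlap≤ {k = k} e f ∣e∣ ∣f∣ with e ≟ˢ f
... | yes refl = ≤-reflexive (begin
  ∣ e ∩ e ∣ C k + ∣ ∁ e ∣ * 1                   ≡⟨ cong (λ s → ∣ s ∣ C k + ∣ ∁ e ∣ * 1) (∩-idem e) ⟩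
  ∣ e ∣ C k + ∣ ∁ e ∣ * 1                       ≡⟨ cong (λ s → s C k + ∣ ∁ e ∣ * 1) ∣e∣ ⟩
  suc k C k + ∣ ∁ e ∣ * 1                       ≡⟨ cong (_+ ∣ ∁ e ∣ * 1) ([1+n]Cn≡1+n k) ⟩
  suc k + ∣ ∁ e ∣ * 1                           ≡⟨ cong₂ _+_ (sym (*-identityʳ (suc k))) (*-identityʳ ∣ ∁ e ∣) ⟩
  suc k * 1 + ∣ ∁ e ∣                           ≡⟨ +-comm (suc k * 1) _ ⟩
  ∣ ∁ e ∣ + suc k * 1                           ≡⟨ cong (_+ suc k * 1) (numSupersets-1+ e ∣e∣) ⟨
  numSupersets (suc (suc k)) e + suc k * 1      ≡⟨ cong (λ s → numSupersets (suc (suc k)) s + suc k * 1) (∪-idem e) ⟨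
  numSupersets (suc (suc k)) (e ∪ e) + suc k * 1 ∎)
  where open ≡-Reasoning
... | no e≢f = +-mono-≤ C≤supersets (≤-trans (≤-reflexive (*-zeroʳ ∣ ∁ e ∣)) z≤n)
  where
  C≤supersets : ∣ e ∩ f ∣ C k ≤ numSupersets (suc (suc k)) (e ∪ f)
  C≤supersets with m<1+n⇒m<n∨m≡n (s≤s (∣p∩q∣≤k e f ∣e∣ ∣f∣ e≢f))
  ... | inj₁ ∣e∩f∣<k = ≤-trans (≤-reflexive (k>n⇒nCk≡0 ∣e∩f∣<k)) z≤n
  ... | inj₂ ∣e∩f∣≡k = ≤-reflexive (begin
    ∣ e ∩ f ∣ C k                          ≡⟨ cong (_C k) ∣e∩f∣≡k ⟩
    k C k                                  ≡⟨ nCn≡1 k ⟩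
    ∣ ∁ (e ∪ f) ∣ C 0                      ≡⟨ numSupersets≡ (e ∪ f) 0 ⟨
    numSupersets ∣ e ∪ f ∣ (e ∪ f)         ≡⟨ cong (λ s → numSupersets s (e ∪ f)) ∣e∪f∣ ⟩
    numSupersets (suc (suc k)) (e ∪ f)     ∎)
    where
    open ≡-Reasoning
    ∣e∪f∣ : ∣ e ∪ f ∣ ≡ suc (suc k)
    ∣e∪f∣ = +-cancelˡ-≡ k _ _ (begin
      k + ∣ e ∪ f ∣           ≡⟨ cong (_+ ∣ e ∪ f ∣) ∣e∩f∣≡k ⟨
      ∣ e ∩ f ∣ + ∣ e ∪ f ∣   ≡⟨ ∣p∩q∣+∣p∪q∣≡∣p∣+∣q∣ e f ⟩
      ∣ e ∣ + ∣ f ∣           ≡⟨ cong₂ _+_ ∣e∣ ∣f∣ ⟩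
      suc k + suc k           ≡⟨ +-suc k (suc k) ⟨
      k + suc (suc k)         ∎)

∣m-n∣²+2mn≡m²+n² : ∀ m n → ∣ m - n ∣ * ∣ m - n ∣ + 2 * m * n ≡ m * m + n * n
∣m-n∣²+2mn≡m²+n² zero    n       = +-identityʳ (n * n)
∣m-n∣²+2mn≡m²+n² (suc m) zero    = cong (suc m * suc m +_) (*-zeroʳ (2 * suc m))
∣m-n∣²+2mn≡m²+n² (suc m) (suc n) = begin
  d * d + 2 * suc m * suc n                ≡⟨ expand (d * d) m n ⟩
  d * d + 2 * m * n + (2 * m + 2 * n + 2)  ≡⟨ cong (_+ (2 * m + 2 * n + 2)) (∣m-n∣²+2mn≡m²+n² m n) ⟩
  m * m + n * n + (2 * m + 2 * n + 2)      ≡⟨ collect m n ⟩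
  suc m * suc m + suc n * suc n            ∎
  where
  open ≡-Reasoning
  d : ℕ
  d = ∣ m - n ∣
  expand : ∀ x m n → x + 2 * suc m * suc n ≡ x + 2 * m * n + (2 * m + 2 * n + 2)
  expand = solve-∀
  collect : ∀ m n → m * m + n * n + (2 * m + 2 * n + 2) ≡ suc m * suc m + suc n * suc n
  collect = solve-∀

∑-variance : ∀ {n} (w x : Subset n → ℕ) c →
  ∑[ S ] (w S * (∣ x S - c ∣ * ∣ x S - c ∣)) + 2 * c * ∑[ S ] (w S * x S)
    ≡ ∑[ S ] (w S * (x S * x S)) + c * c * ∑ w
∑-variance {n} w x c = begin
  ∑[ S ] (w S * (d S * d S)) + 2 * c * ∑[ S ] (w S * x S)
    ≡⟨ ∑-*-+ w (λ S → d S * d S) x (2 * c) ⟨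
  ∑[ S ] (w S * (d S * d S + 2 * c * x S))
    ≡⟨ ∑-cong (λ S → cong (w S *_) (pointwise S)) ⟩
  ∑[ S ] (w S * (x S * x S + c * c * 1))
    ≡⟨ ∑-*-+ w (λ S → x S * x S) (λ _ → 1) (c * c) ⟩
  ∑[ S ] (w S * (x S * x S)) + c * c * ∑[ S ] (w S * 1)
    ≡⟨ cong (λ s → ∑[ S ] (w S * (x S * x S)) + c * c * s) (∑-cong (λ S → *-identityʳ (w S))) ⟩
  ∑[ S ] (w S * (x S * x S)) + c * c * ∑ w ∎
  where
  open ≡-Reasoning
  d : Subset n → ℕ
  d S = ∣ x S - c ∣
  pointwise : ∀ S → d S * d S + 2 * c * x S ≡ x S * x S + c * c * 1
  pointwise S = begin
    d S * d S + 2 * c * x S   ≡⟨ cong (d S * d S +_) (swap c (x S)) ⟩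
    d S * d S + 2 * x S * c   ≡⟨ ∣m-n∣²+2mn≡m²+n² (x S) c ⟩
    x S * x S + c * c         ≡⟨ cong (x S * x S +_) (*-identityʳ (c * c)) ⟨
    x S * x S + c * c * 1     ∎
    where
    swap : ∀ c y → 2 * c * y ≡ 2 * y * c
    swap = solve-∀

-- Double counting in hypergraphs

χ : ∀ {n} → Hypergraph n → Subset n → ℕ
χ H e = ⟦ isEdge H e ⟧

module _ {n} (H : Hypergraph n) where

  numEdges≡∑χ : numEdges H ≡ ∑ (χ H)
  numEdges≡∑χ = length-filterᵇ-allSubsets (isEdge H)

  length-filterᵇ-edges : (p : Subset n → Bool) → length (filterᵇ p (edges H)) ≡ ∑[ e ] (χ H e * ⟦ p e ⟧)
  length-filterᵇ-edges p = begin
    length (filterᵇ p (edges H))                              ≡⟨ length-filterᵇ-filterᵇ (isEdge H) p (allSubsets n) ⟩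
    length (filterᵇ (λ e → isEdge H e ∧ p e) (allSubsets n))  ≡⟨ length-filterᵇ-allSubsets {n} _ ⟩
    ∑[ e ] ⟦ isEdge H e ∧ p e ⟧                               ≡⟨ ∑-cong (λ e → ⟦∧⟧ (isEdge H e) (p e)) ⟩
    ∑[ e ] (χ H e * ⟦ p e ⟧)                                  ∎
    where open ≡-Reasoning

  numEdges≡0 : ∀ {r} → Uniform r H → n < r → numEdges H ≡ 0
  numEdges≡0 uniform n<r = trans numEdges≡∑χ (∑-zero no-edge)
    where
    no-edge : ∀ e → χ H e ≡ 0
    no-edge e with isEdge H e in e∈H
    ... | true  = contradiction (subst (_≤ n) (uniform e e∈H) (∣p∣≤n e)) (<⇒≱ n<r)
    ... | false = refl

  degree² : ∀ S → degree H S * degree H S ≡ ∑[ e ] ∑[ f ] (χ H e * χ H f * ⟦ S ⊆ᵇ (e ∩ f) ⟧)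
  degree² S = begin
    degree H S * degree H S
      ≡⟨ cong₂ _*_ (length-filterᵇ-edges (S ⊆ᵇ_)) (length-filterᵇ-edges (S ⊆ᵇ_)) ⟩
    ∑[ e ] (χ H e * ⟦ S ⊆ᵇ e ⟧) * ∑[ f ] (χ H f * ⟦ S ⊆ᵇ f ⟧)
      ≡⟨ ∑-*-∑ (λ e → χ H e * ⟦ S ⊆ᵇ e ⟧) (λ f → χ H f * ⟦ S ⊆ᵇ f ⟧) ⟩
    ∑[ e ] ∑[ f ] ((χ H e * ⟦ S ⊆ᵇ e ⟧) * (χ H f * ⟦ S ⊆ᵇ f ⟧))
      ≡⟨ ∑-cong (λ e → ∑-cong (λ f → trans (*-CS.interchange (χ H e) _ _ _)
           (cong (χ H e * χ H f *_) (trans (sym (⟦∧⟧ (S ⊆ᵇ e) (S ⊆ᵇ f))) (cong ⟦_⟧ (⊆ᵇ-∩ S e f)))))) ⟩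
    ∑[ e ] ∑[ f ] (χ H e * χ H f * ⟦ S ⊆ᵇ (e ∩ f) ⟧) ∎
    where open ≡-Reasoning

  ∑-degree : ∀ k → ∑[ S ] (⟦ ∣ S ∣ ≡ᵇ k ⟧ * degree H S) ≡ ∑[ e ] (χ H e * (∣ e ∣ C k))
  ∑-degree k = begin
    ∑[ S ] (w S * degree H S)
      ≡⟨ ∑-cong (λ S → trans (cong (w S *_) (length-filterᵇ-edges (S ⊆ᵇ_))) (sym (∑-*ˡ {n} (w S) _))) ⟩
    ∑[ S ] ∑[ e ] (w S * (χ H e * ⟦ S ⊆ᵇ e ⟧))
      ≡⟨ ∑-cong (λ S → ∑-cong (λ e → *-CS.x∙yz≈y∙xz (w S) (χ H e) _)) ⟩
    ∑[ S ] ∑[ e ] (χ H e * (w S * ⟦ S ⊆ᵇ e ⟧))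
      ≡⟨ ∑-swap {n} {n} _ ⟩
    ∑[ e ] ∑[ S ] (χ H e * (w S * ⟦ S ⊆ᵇ e ⟧))
      ≡⟨ ∑-cong (λ e → trans (∑-*ˡ {n} (χ H e) _) (cong (χ H e *_) (∑-subsets e k))) ⟩
    ∑[ e ] (χ H e * (∣ e ∣ C k)) ∎
    where
    open ≡-Reasoning
    w : Subset n → ℕ
    w S = ⟦ ∣ S ∣ ≡ᵇ k ⟧

  ∑-degree² : ∀ k → ∑[ S ] (⟦ ∣ S ∣ ≡ᵇ k ⟧ * (degree H S * degree H S))
                    ≡ ∑[ e ] ∑[ f ] (χ H e * χ H f * (∣ e ∩ f ∣ C k))
  ∑-degree² k = begin
    ∑[ S ] (w S * (degree H S * degree H S))
      ≡⟨ ∑-cong (λ S → cong (w S *_) (degree² S)) ⟩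
    ∑[ S ] (w S * ∑[ e ] ∑[ f ] (χ H e * χ H f * ⟦ S ⊆ᵇ (e ∩ f) ⟧))
      ≡⟨ ∑-cong (λ S → trans (sym (∑-*ˡ {n} (w S) _)) (∑-cong (λ e → trans (sym (∑-*ˡ {n} (w S) _))
           (∑-cong (λ f → *-CS.x∙yz≈y∙xz (w S) (χ H e * χ H f) _))))) ⟩
    ∑[ S ] ∑[ e ] ∑[ f ] (χ H e * χ H f * (w S * ⟦ S ⊆ᵇ (e ∩ f) ⟧))
      ≡⟨ ∑-swap {n} {n} _ ⟩
    ∑[ e ] ∑[ S ] ∑[ f ] (χ H e * χ H f * (w S * ⟦ S ⊆ᵇ (e ∩ f) ⟧))
      ≡⟨ ∑-cong (λ e → ∑-swap {n} {n} (λ S f → χ H e * χ H f * (w S * ⟦ S ⊆ᵇ (e ∩ f) ⟧))) ⟩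
    ∑[ e ] ∑[ f ] ∑[ S ] (χ H e * χ H f * (w S * ⟦ S ⊆ᵇ (e ∩ f) ⟧))
      ≡⟨ ∑-cong (λ e → ∑-cong (λ f → trans (∑-*ˡ {n} (χ H e * χ H f) _)
           (cong (χ H e * χ H f *_) (∑-subsets (e ∩ f) k)))) ⟩
    ∑[ e ] ∑[ f ] (χ H e * χ H f * (∣ e ∩ f ∣ C k)) ∎
    where
    open ≡-Reasoning
    w : Subset n → ℕ
    w S = ⟦ ∣ S ∣ ≡ᵇ k ⟧

Sparse : ∀ {n} → ℕ → Hypergraph n → Set
Sparse r H = ∀ T → ∣ T ∣ ≡ suc r → edgesInside H T ≤ 2

module SparseUniform {n K} (H : Hypergraph n) (uniform : Uniform (suc K) H) (sparse : Sparse (suc K) H) where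

  private
    r m : ℕ
    r = suc K
    m = numEdges H
    w x dev : Subset n → ℕ
    w S = ⟦ ∣ S ∣ ≡ᵇ K ⟧
    x S = r * degree H S
    -- stands in for the signed deviation r·d(S) − n, which ℕ cannot express
    dev S = ∣ x S - n ∣

  ∑χ-numSupersets≤ : ∀ e → ∣ e ∣ ≡ suc K →
    ∑[ f ] (χ H f * numSupersets (suc (suc K)) (e ∪ f)) ≤ 2 * ∣ ∁ e ∣
  ∑χ-numSupersets≤ e ∣e∣ = begin
    ∑[ f ] (χ H f * ∑[ T ] (v T * ⟦ (e ∪ f) ⊆ᵇ T ⟧))
      ≡⟨ ∑-cong (λ f → trans (sym (∑-*ˡ {n} (χ H f) _)) (∑-cong (λ T → split f T))) ⟩
    ∑[ f ] ∑[ T ] (v T * ⟦ e ⊆ᵇ T ⟧ * (χ H f * ⟦ f ⊆ᵇ T ⟧))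
      ≡⟨ ∑-swap {n} {n} _ ⟩
    ∑[ T ] ∑[ f ] (v T * ⟦ e ⊆ᵇ T ⟧ * (χ H f * ⟦ f ⊆ᵇ T ⟧))
      ≡⟨ ∑-cong (λ T → trans (∑-*ˡ {n} (v T * ⟦ e ⊆ᵇ T ⟧) _)
           (cong (v T * ⟦ e ⊆ᵇ T ⟧ *_) (sym (length-filterᵇ-edges H (_⊆ᵇ T))))) ⟩
    ∑[ T ] (v T * ⟦ e ⊆ᵇ T ⟧ * edgesInside H T)
      ≤⟨ ∑-mono inside≤2 ⟩
    ∑[ T ] (v T * ⟦ e ⊆ᵇ T ⟧ * 2)
      ≡⟨ ∑-cong (λ T → *-comm (v T * ⟦ e ⊆ᵇ T ⟧) 2) ⟩
    ∑[ T ] (2 * (v T * ⟦ e ⊆ᵇ T ⟧))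
      ≡⟨ ∑-*ˡ 2 (λ T → v T * ⟦ e ⊆ᵇ T ⟧) ⟩
    2 * numSupersets (suc (suc K)) e
      ≡⟨ cong (2 *_) (numSupersets-1+ e ∣e∣) ⟩
    2 * ∣ ∁ e ∣ ∎
    where
    open ≤-Reasoning
    v : Subset n → ℕ
    v T = ⟦ ∣ T ∣ ≡ᵇ suc (suc K) ⟧
    split : ∀ f T → χ H f * (v T * ⟦ (e ∪ f) ⊆ᵇ T ⟧) ≡ v T * ⟦ e ⊆ᵇ T ⟧ * (χ H f * ⟦ f ⊆ᵇ T ⟧)
    split f T = begin-equality
      χ H f * (v T * ⟦ (e ∪ f) ⊆ᵇ T ⟧)              ≡⟨ cong (λ b → χ H f * (v T * ⟦ b ⟧)) (∪-⊆ᵇ e f T) ⟨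
      χ H f * (v T * ⟦ (e ⊆ᵇ T) ∧ (f ⊆ᵇ T) ⟧)      ≡⟨ cong (λ x → χ H f * (v T * x)) (⟦∧⟧ (e ⊆ᵇ T) (f ⊆ᵇ T)) ⟩
      χ H f * (v T * (⟦ e ⊆ᵇ T ⟧ * ⟦ f ⊆ᵇ T ⟧))     ≡⟨ rearrange (χ H f) (v T) _ _ ⟩
      v T * ⟦ e ⊆ᵇ T ⟧ * (χ H f * ⟦ f ⊆ᵇ T ⟧)       ∎
      where
      rearrange : ∀ a b c d → a * (b * (c * d)) ≡ b * c * (a * d)
      rearrange = solve-∀
    inside≤2 : ∀ T → v T * ⟦ e ⊆ᵇ T ⟧ * edgesInside H T ≤ v T * ⟦ e ⊆ᵇ T ⟧ * 2
    inside≤2 T with ∣ T ∣ ≡ᵇ suc (suc K) in ∣T∣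
    ... | true  = *-monoʳ-≤ (1 * ⟦ e ⊆ᵇ T ⟧) (sparse T (≡ᵇ⇒≡′ ∣T∣))
    ... | false = z≤n

  overlaps≤n : ∀ e → isEdge H e ≡ true → ∑[ f ] (χ H f * (∣ e ∩ f ∣ C K)) ≤ n
  overlaps≤n e e∈H = begin
    ov                       ≤⟨ +-cancelʳ-≤ (∣ ∁ e ∣) ov (suc K + ∣ ∁ e ∣) (begin
      ov + ∣ ∁ e ∣   ≡⟨ cong (ov +_) (trans (sym (*-identityʳ ∣ ∁ e ∣)) (cong (∣ ∁ e ∣ *_) (sym ∑χδ≡1))) ⟩
      ∑[ f ] (χ H f * (∣ e ∩ f ∣ C K)) + ∣ ∁ e ∣ * ∑[ f ] (χ H f * δ e f)
        ≡⟨ ∑-*-+ (χ H) (λ f → ∣ e ∩ f ∣ C K) (δ e) ∣ ∁ e ∣ ⟨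
      ∑[ f ] (χ H f * (∣ e ∩ f ∣ C K + ∣ ∁ e ∣ * δ e f))
        ≤⟨ ∑-mono (λ f → edgewise f) ⟩
      ∑[ f ] (χ H f * (N f + suc K * δ e f))
        ≡⟨ ∑-*-+ (χ H) N (δ e) (suc K) ⟩
      ∑[ f ] (χ H f * N f) + suc K * ∑[ f ] (χ H f * δ e f)
        ≤⟨ +-mono-≤ (∑χ-numSupersets≤ e ∣e∣) (≤-reflexive (cong (suc K *_) ∑χδ≡1)) ⟩
      2 * ∣ ∁ e ∣ + suc K * 1   ≡⟨ rearrange ∣ ∁ e ∣ (suc K) ⟩
      suc K + ∣ ∁ e ∣ + ∣ ∁ e ∣ ∎) ⟩
    suc K + ∣ ∁ e ∣          ≡⟨ cong (_+ ∣ ∁ e ∣) ∣e∣ ⟨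
    ∣ e ∣ + ∣ ∁ e ∣          ≡⟨ cong (∣ e ∣ +_) (∣∁p∣≡n∸∣p∣ e) ⟩
    ∣ e ∣ + (n ∸ ∣ e ∣)      ≡⟨ m+[n∸m]≡n (∣p∣≤n e) ⟩
    n                        ∎
    where
    open ≤-Reasoning
    ov : ℕ
    ov = ∑[ f ] (χ H f * (∣ e ∩ f ∣ C K))
    N : Subset n → ℕ
    N f = numSupersets (suc (suc K)) (e ∪ f)
    ∣e∣ : ∣ e ∣ ≡ suc K
    ∣e∣ = uniform e e∈H
    ∑χδ≡1 : ∑[ f ] (χ H f * δ e f) ≡ 1
    ∑χδ≡1 = trans (∑-δ (χ H) e) (cong ⟦_⟧ e∈H)
    rearrange : ∀ c r → 2 * c + r * 1 ≡ r + c + c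
    rearrange = solve-∀
    edgewise : ∀ f → χ H f * (∣ e ∩ f ∣ C K + ∣ ∁ e ∣ * δ e f) ≤ χ H f * (N f + suc K * δ e f)
    edgewise f with isEdge H f in f∈H
    ... | true  = *-monoʳ-≤ 1 (C-overlap≤ e f ∣e∣ (uniform f f∈H))
    ... | false = z≤n

  variance : ℕ
  variance = ∑[ S ] (w S * (dev S * dev S))

  ∑wx≡ : ∑[ S ] (w S * x S) ≡ r * (r * m)
  ∑wx≡ = begin
    ∑[ S ] (w S * (r * degree H S))   ≡⟨ ∑-cong (λ S → *-CS.x∙yz≈y∙xz (w S) r _) ⟩
    ∑[ S ] (r * (w S * degree H S))   ≡⟨ ∑-*ˡ r (λ S → w S * degree H S) ⟩
    r * ∑[ S ] (w S * degree H S)     ≡⟨ cong (r *_) (∑-degree H K) ⟩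
    r * ∑[ e ] (χ H e * (∣ e ∣ C K))  ≡⟨ cong (r *_) (∑-cong χ·C≡r·χ) ⟩
    r * ∑[ e ] (r * χ H e)            ≡⟨ cong (r *_) (∑-*ˡ r (χ H)) ⟩
    r * (r * ∑ (χ H))                 ≡⟨ cong (λ s → r * (r * s)) (numEdges≡∑χ H) ⟨
    r * (r * m)                       ∎
    where
    open ≡-Reasoning
    χ·C≡r·χ : ∀ e → χ H e * (∣ e ∣ C K) ≡ r * χ H e
    χ·C≡r·χ e with isEdge H e in e∈H
    ... | true  = trans (*-identityˡ _) (trans (cong (_C K) (uniform e e∈H))
                    (trans ([1+n]Cn≡1+n K) (sym (*-identityʳ r))))
    ... | false = sym (*-zeroʳ r)

  ∑wx²≤ : ∑[ S ] (w S * (x S * x S)) ≤ r * r * (n * m)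
  ∑wx²≤ = begin
    ∑[ S ] (w S * (x S * x S))
      ≡⟨ ∑-cong (λ S → pull-out r (w S) (degree H S)) ⟩
    ∑[ S ] (r * r * (w S * (degree H S * degree H S)))
      ≡⟨ ∑-*ˡ (r * r) (λ S → w S * (degree H S * degree H S)) ⟩
    r * r * ∑[ S ] (w S * (degree H S * degree H S))
      ≡⟨ cong (r * r *_) (∑-degree² H K) ⟩
    r * r * ∑[ e ] ∑[ f ] (χ H e * χ H f * (∣ e ∩ f ∣ C K))
      ≡⟨ cong (r * r *_) (∑-cong λ e → trans (∑-cong λ f → *-assoc (χ H e) (χ H f) _) (∑-*ˡ {n} (χ H e) _)) ⟩
    r * r * ∑[ e ] (χ H e * ∑[ f ] (χ H f * (∣ e ∩ f ∣ C K)))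
      ≤⟨ *-monoʳ-≤ (r * r) (∑-mono edgewise) ⟩
    r * r * ∑[ e ] (n * χ H e)
      ≡⟨ cong (r * r *_) (trans (∑-*ˡ n (χ H)) (cong (n *_) (sym (numEdges≡∑χ H)))) ⟩
    r * r * (n * m) ∎
    where
    open ≤-Reasoning
    pull-out : ∀ r w d → w * (r * d * (r * d)) ≡ r * r * (w * (d * d))
    pull-out = solve-∀
    edgewise : ∀ e → χ H e * ∑[ f ] (χ H f * (∣ e ∩ f ∣ C K)) ≤ n * χ H e
    edgewise e with isEdge H e in e∈H
    ... | true  = subst₂ _≤_ (sym (*-identityˡ _)) (sym (*-identityʳ n)) (overlaps≤n e e∈H)
    ... | false = z≤n

  variance-bound : variance + n * (r * r * m) ≤ n * (n * (n C K))
  variance-bound = +-cancelʳ-≤ (n * (r * r * m)) _ _ (begin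
    variance + n * (r * r * m) + n * (r * r * m)   ≡⟨ double variance n r m ⟩
    variance + 2 * n * (r * (r * m))               ≡⟨ cong (λ s → variance + 2 * n * s) ∑wx≡ ⟨
    variance + 2 * n * ∑[ S ] (w S * x S)          ≡⟨ ∑-variance w x n ⟩
    ∑[ S ] (w S * (x S * x S)) + n * n * ∑ w       ≤⟨ +-mono-≤ ∑wx²≤ (≤-reflexive (cong (n * n *_) (∑-size n K))) ⟩
    r * r * (n * m) + n * n * (n C K)              ≡⟨ regroup n r m (n C K) ⟩
    n * (n * (n C K)) + n * (r * r * m)            ∎)
    where
    open ≤-Reasoning
    double : ∀ v n r m → v + n * (r * r * m) + n * (r * r * m) ≡ v + 2 * n * (r * (r * m))
    double = solve-∀
    regroup : ∀ n r m N → r * r * (n * m) + n * n * N ≡ n * (n * N) + n * (r * r * m)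
    regroup = solve-∀

  edge-bound : r * r * m ≤ n * (n C K)
  edge-bound with n ≟ 0
  ... | yes n≡0 = ≤-trans (≤-reflexive no-edges) z≤n
    where
    no-edges : r * r * m ≡ 0
    no-edges = trans (cong (r * r *_) (numEdges≡0 H uniform (subst (_< r) (sym n≡0) z<s))) (*-zeroʳ (r * r))
  ... | no  n≢0 = *-cancelˡ-≤ n {{≢-nonZero n≢0}} (≤-trans (m≤n+m _ variance) variance-bound)

  equality⇒regular : r * r * m ≡ n * (n C K) → ∀ S → ∣ S ∣ ≡ K → r * degree H S ≡ n
  equality⇒regular eq S ∣S∣ = ∣m-n∣≡0⇒m≡n (reduce (m*n≡0⇒m≡0∨n≡0 _ d²≡0))
    where
    variance≡0 : variance ≡ 0
    variance≡0 = n≤0⇒n≡0 (+-cancelʳ-≤ (n * (r * r * m)) variance 0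
      (subst (λ t → variance + n * (r * r * m) ≤ n * t) (sym eq) variance-bound))
    wS≡1 : w S ≡ 1
    wS≡1 = trans (cong (λ s → ⟦ s ≡ᵇ K ⟧) ∣S∣) (⟦n≡ᵇn⟧ K)
    d²≡0 : dev S * dev S ≡ 0
    d²≡0 = begin
      dev S * dev S       ≡⟨ *-identityˡ _ ⟨
      1 * (dev S * dev S) ≡⟨ cong (_* (dev S * dev S)) wS≡1 ⟨
      w S * (dev S * dev S) ≡⟨ n≤0⇒n≡0 (subst (w S * (dev S * dev S) ≤_) variance≡0 (term≤∑ (λ S → w S * (dev S * dev S)) S)) ⟩
      0 ∎
      where open ≡-Reasoning

  regular⇒equality : (∀ S → ∣ S ∣ ≡ K → r * degree H S ≡ n) → r * r * m ≡ n * (n C K)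
  regular⇒equality regular = begin
    r * r * m                 ≡⟨ *-assoc r r m ⟩
    r * (r * m)               ≡⟨ ∑wx≡ ⟨
    ∑[ S ] (w S * x S)        ≡⟨ ∑-cong pointwise ⟩
    ∑[ S ] (n * w S)          ≡⟨ ∑-*ˡ n w ⟩
    n * ∑ w                   ≡⟨ cong (n *_) (∑-size n K) ⟩
    n * (n C K)               ∎
    where
    open ≡-Reasoning
    pointwise : ∀ S → w S * x S ≡ n * w S
    pointwise S with ∣ S ∣ ≡ᵇ K in ∣S∣
    ... | true  = trans (*-identityˡ (x S)) (trans (regular S (≡ᵇ⇒≡′ ∣S∣)) (sym (*-identityʳ n)))
    ... | false = sym (*-zeroʳ n)

proposition4p1 : (r n : ℕ) → 2 ≤ r → (H : Hypergraph n) → Uniform r H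
    → (∀ (T : Subset n) → ∣ T ∣ ≡ suc r → edgesInside H T ≤ 2)
    → (r * r * numEdges H ≤ n * (n C (r ∸ 1)))
      × ((r * r * numEdges H ≡ n * (n C (r ∸ 1)))
         ⇔ (∀ (S : Subset n) → ∣ S ∣ ≡ r ∸ 1 → r * degree H S ≡ n))
proposition4p1 zero    _ () _ _ _
-- The argument needs only r ≥ 1.
proposition4p1 (suc K) n _ H uniform sparse =
  edge-bound , mk⇔ equality⇒regular regular⇒equality
  where open SparseUniform H uniform sparse
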